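{- Let $\mathcal{D}$ be the set of all Dyck paths, and for $D\in\mathcal{D}$ let $|D|$ be its semilength and $\mathrm{spw}(D)$ (resp. $\mathrm{apw}(D)$) the sum of the weights of its symmetric (resp. asymmetric) peaks. Then $$\sum_{D\in\mathcal{D}}\mathrm{spw}(D)z^{|D|}=\frac{5z-1+(1-z)\sqrt{1-4z}}{2(1-z)^2\sqrt{1-4z}},\qquad \sum_{D\in\mathcal{D}}\mathrm{apw}(D)z^{|D|}=\frac{1-3z-(1-z)\sqrt{1-4z}}{(1-z)^2\sqrt{1-4z}}.$$
   Context: A Dyck path of semilength $n$ is a lattice path with steps $\mathbf{u}=(1,1)$ and $\mathbf{d}=(1,-1)$ from $(0,0)$ to $(2n,0)$ never going below the $x$-axis. A peak is an occurrence of consecutive steps $\mathbf{ud}$. Every peak extends to a unique maximal consecutive subsequence $\mathbf{u}^i\mathbf{d}^j$ ($i,j\ge 1$), its maximal mountain; the peak is symmetric if $i=j$ and asymmetric otherwise, and its weight is $\min\{i,j\}$. -}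

module Defs where

open import Data.Nat as ℕ using (ℕ; zero; suc; _⊓_; _≡ᵇ_)
open import Data.Integer as ℤ using (ℤ; +_; -[1+_])
open import Data.List using (List; []; _∷_; map; filter; upTo; concatMap; foldr)
open import Data.Bool using (Bool; true; false; if_then_else_; T)
open import Data.Product using (_×_; _,_)
open import Relation.Binary.PropositionalEquality using (_≡_)
open import Relation.Nullary.Decidable using (T?)

data Step : Set where
  u d : Step

words : ℕ → List (List Step)
words zero    = [] ∷ []
words (suc k) = concatMap (λ w → (u ∷ w) ∷ (d ∷ w) ∷ []) (words k)

dyckFrom : ℕ → List Step → Bool
dyckFrom h       []       = h ≡ᵇ 0
dyckFrom h       (u ∷ xs) = dyckFrom (suc h) xs
dyckFrom zero    (d ∷ xs) = false
dyckFrom (suc h) (d ∷ xs) = dyckFrom h xs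

isDyck : List Step → Bool
isDyck = dyckFrom 0

dyckPaths : ℕ → List (List Step)
dyckPaths n = filter (λ w → T? (isDyck w)) (words (2 ℕ.* n))

sameStep : Step → Step → Bool
sameStep u u = true
sameStep d d = true
sameStep _ _ = false

runs : List Step → List (Step × ℕ)
runs [] = []
runs (s ∷ xs) with runs xs
... | [] = (s , 1) ∷ []
... | (t , k) ∷ r = if sameStep s t then (s , suc k) ∷ r else (s , 1) ∷ (t , k) ∷ r

-- each peak ud lies in a unique maximal mountain u^i d^j,
-- i.e. a u-run of length i immediately followed by a d-run of length j
mountainsR : List (Step × ℕ) → List (ℕ × ℕ)
mountainsR ((u , i) ∷ (d , j) ∷ rest) = (i , j) ∷ mountainsR ((d , j) ∷ rest)
mountainsR (_ ∷ rest) = mountainsR rest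
mountainsR [] = []

mountains : List Step → List (ℕ × ℕ)
mountains w = mountainsR (runs w)

sumℕ : List ℕ → ℕ
sumℕ = foldr ℕ._+_ 0

spw : List Step → ℕ
spw w = sumℕ (map (λ { (i , j) → if i ≡ᵇ j then i ⊓ j else 0 }) (mountains w))

apw : List Step → ℕ
apw w = sumℕ (map (λ { (i , j) → if i ≡ᵇ j then 0 else i ⊓ j }) (mountains w))

PS : Set
PS = ℕ → ℤ

_≈ₚ_ : PS → PS → Set
f ≈ₚ g = ∀ n → f n ≡ g n

sumℤ : List ℤ → ℤ
sumℤ = foldr ℤ._+_ (+ 0)

_+ₚ_ : PS → PS → PS
(f +ₚ g) n = f n ℤ.+ g n

_-ₚ_ : PS → PS → PS
(f -ₚ g) n = f n ℤ.- g n

_*ₚ_ : PS → PS → PS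
(f *ₚ g) n = sumℤ (map (λ k → f k ℤ.* g (n ℕ.∸ k)) (upTo (suc n)))

infixl 6 _+ₚ_ _-ₚ_
infixl 7 _*ₚ_
infix 4 _≈ₚ_

poly : List ℤ → PS
poly []       n       = + 0
poly (a ∷ as) zero    = a
poly (a ∷ as) (suc n) = poly as n

SPW : PS
SPW n = + sumℕ (map spw (dyckPaths n))

APW : PS
APW n = + sumℕ (map apw (dyckPaths n))

-- Deleting the peak ud of a mountain u^i d^j with i, j ≥ 2 is a bijection between Dyck paths of
-- semilength n + 1 with such a marked mountain and Dyck paths of semilength n with a marked mountain
-- u^(i-1) d^(j-1).  Hence the total over paths of semilength n + 1 of a weight g(i, j) on mountains with
-- min(i, j) ≥ 2 equals the total of g(i + 1, j + 1) over all mountains at semilength n, and for spw and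
-- apw the totals become partial sums of totals over mountains with min(i, j) = 1.  A mountain ud arises by
-- inserting ud into a shorter path at a position preceded by a down-step or the start and followed by an
-- up-step or the end, and there are 1 + #peaks such positions; the same bijection applied to the weight 1
-- shows that the mountains with min(i, j) = 1 at semilength n + 1 number P(n + 1) - P(n), where P(n) is the
-- total number of peaks at semilength n.  The first-return decomposition gives C = 1 + zC² and
-- P = z(C + 2CP) for the series of Catalan numbers and of peaks; the square root of 1 - 4z with constant
-- term 1 is unique, so it equals 1 - 2zC, and both identities become computations in the ring of series.

module Submission where

open import Defs
open import Data.List using (_∷_; [])
open import Data.Product using (_×_; _,_)
open import Relation.Binary.PropositionalEquality using (_≡_)

module Paths where

  open import Data.Nat using (ℕ; zero; suc; _+_; _*_; _<_; s≤s)
  open import Data.Nat.Properties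
    using (m<n⇒m<1+n; m≤n⇒m≤1+n; ≤-reflexive; +-identityʳ; +-suc; suc-injective; +-assoc; +-comm; *-comm;
           *-distribˡ-+; +-commutativeSemigroup)
  open import Data.Bool using (Bool; true; false; T; if_then_else_)
  open import Relation.Nullary.Decidable using (T?)
  open import Data.List using (List; _++_; map; filter; concatMap)
  open import Function using (_∘_)
  open import Relation.Binary.PropositionalEquality
  open import Algebra.Properties.CommutativeSemigroup +-commutativeSemigroup
    using (x∙yz≈y∙xz) renaming (interchange to +-interchange)

  -- Σᴰ k h F sums F over the paths with k up-steps from height h down to height 0 that never go below 0.
  -- Every such path has length 2k + h, so counting up-steps rather than steps avoids parity arguments.
  Σᴰ : ℕ → ℕ → (List Step → ℕ) → ℕ
  Σᴰ zero    zero    F = F []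
  Σᴰ zero    (suc h) F = Σᴰ zero h (F ∘ (d ∷_))
  Σᴰ (suc k) zero    F = Σᴰ k 1 (F ∘ (u ∷_))
  Σᴰ (suc k) (suc h) F = Σᴰ k (suc (suc h)) (F ∘ (u ∷_)) + Σᴰ (suc k) h (F ∘ (d ∷_))

  Σᴰ-cong-dyck : ∀ k h {F G : List Step → ℕ} → (∀ w → T (dyckFrom h w) → F w ≡ G w) →
    Σᴰ k h F ≡ Σᴰ k h G
  Σᴰ-cong-dyck zero    zero    eq = eq [] _
  Σᴰ-cong-dyck zero    (suc h) eq = Σᴰ-cong-dyck zero h (eq ∘ (d ∷_))
  Σᴰ-cong-dyck (suc k) zero    eq = Σᴰ-cong-dyck k 1 (eq ∘ (u ∷_))
  Σᴰ-cong-dyck (suc k) (suc h) eq =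
    cong₂ _+_ (Σᴰ-cong-dyck k (suc (suc h)) (eq ∘ (u ∷_))) (Σᴰ-cong-dyck (suc k) h (eq ∘ (d ∷_)))

  Σᴰ-cong : ∀ k h {F G : List Step → ℕ} → (∀ w → F w ≡ G w) → Σᴰ k h F ≡ Σᴰ k h G
  Σᴰ-cong k h eq = Σᴰ-cong-dyck k h (λ w _ → eq w)

  Σᴰ-+ : ∀ k h (F G : List Step → ℕ) → Σᴰ k h (λ w → F w + G w) ≡ Σᴰ k h F + Σᴰ k h G
  Σᴰ-+ zero    zero    F G = refl
  Σᴰ-+ zero    (suc h) F G = Σᴰ-+ zero h (F ∘ (d ∷_)) (G ∘ (d ∷_))
  Σᴰ-+ (suc k) zero    F G = Σᴰ-+ k 1 (F ∘ (u ∷_)) (G ∘ (u ∷_))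
  Σᴰ-+ (suc k) (suc h) F G =
    trans (cong₂ _+_ (Σᴰ-+ k (2 + h) (F ∘ (u ∷_)) (G ∘ (u ∷_)))
                     (Σᴰ-+ (suc k) h (F ∘ (d ∷_)) (G ∘ (d ∷_))))
          (+-interchange (Σᴰ k (2 + h) (F ∘ (u ∷_))) (Σᴰ k (2 + h) (G ∘ (u ∷_)))
                         (Σᴰ (suc k) h (F ∘ (d ∷_))) (Σᴰ (suc k) h (G ∘ (d ∷_))))

  Σᴰ-*ˡ : ∀ k h c (F : List Step → ℕ) → Σᴰ k h (λ w → c * F w) ≡ c * Σᴰ k h F
  Σᴰ-*ˡ zero    zero    c F = refl
  Σᴰ-*ˡ zero    (suc h) c F = Σᴰ-*ˡ zero h c (F ∘ (d ∷_))
  Σᴰ-*ˡ (suc k) zero    c F = Σᴰ-*ˡ k 1 c (F ∘ (u ∷_))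
  Σᴰ-*ˡ (suc k) (suc h) c F =
    trans (cong₂ _+_ (Σᴰ-*ˡ k (2 + h) c (F ∘ (u ∷_))) (Σᴰ-*ˡ (suc k) h c (F ∘ (d ∷_))))
          (sym (*-distribˡ-+ c _ _))

  Σᴰ-0 : ∀ k h → Σᴰ k h (λ _ → 0) ≡ 0
  Σᴰ-0 k h = Σᴰ-*ˡ k h 0 (λ _ → 0)

  Σᴰ-vanishing : ∀ k h {F : List Step → ℕ} → (∀ w → F w ≡ 0) → Σᴰ k h F ≡ 0
  Σᴰ-vanishing k h eq = trans (Σᴰ-cong k h eq) (Σᴰ-0 k h)

  Σᴰ-product : ∀ p g q h (F G : List Step → ℕ) →
    Σᴰ p g (λ x → Σᴰ q h (λ y → F x * G y)) ≡ Σᴰ p g F * Σᴰ q h G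
  Σᴰ-product p g q h F G = begin
    Σᴰ p g (λ x → Σᴰ q h (λ y → F x * G y)) ≡⟨ Σᴰ-cong p g (λ x → Σᴰ-*ˡ q h (F x) G) ⟩
    Σᴰ p g (λ x → F x * Σᴰ q h G)            ≡⟨ Σᴰ-cong p g (λ x → *-comm (F x) (Σᴰ q h G)) ⟩
    Σᴰ p g (λ x → Σᴰ q h G * F x)            ≡⟨ Σᴰ-*ˡ p g (Σᴰ q h G) F ⟩
    Σᴰ q h G * Σᴰ p g F                      ≡⟨ *-comm (Σᴰ q h G) (Σᴰ p g F) ⟩
    Σᴰ p g F * Σᴰ q h G                      ∎
    where open ≡-Reasoning

  convolve : (ℕ → ℕ → ℕ) → ℕ → ℕ
  convolve Φ zero    = Φ 0 0
  convolve Φ (suc n) = Φ 0 (suc n) + convolve (λ p q → Φ (suc p) q) n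

  convolve-cong : ∀ n {Φ Ψ : ℕ → ℕ → ℕ} → (∀ p q → Φ p q ≡ Ψ p q) → convolve Φ n ≡ convolve Ψ n
  convolve-cong zero    eq = eq 0 0
  convolve-cong (suc n) eq = cong₂ _+_ (eq 0 (suc n)) (convolve-cong n (λ p → eq (suc p)))

  convolve-+ : ∀ n (Φ Ψ : ℕ → ℕ → ℕ) → convolve (λ p q → Φ p q + Ψ p q) n ≡ convolve Φ n + convolve Ψ n
  convolve-+ zero    Φ Ψ = refl
  convolve-+ (suc n) Φ Ψ =
    trans (cong (Φ 0 (suc n) + Ψ 0 (suc n) +_) (convolve-+ n (λ p → Φ (suc p)) (λ p → Ψ (suc p))))
          (+-interchange (Φ 0 (suc n)) (Ψ 0 (suc n)) _ _)

  Σᴰ-first-return : ∀ k g h (F : List Step → ℕ) →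
    Σᴰ k (suc (g + h)) F ≡ convolve (λ p q → Σᴰ p g (λ x → Σᴰ q h (λ y → F (x ++ d ∷ y)))) k
  Σᴰ-first-return zero    zero    h F = refl
  Σᴰ-first-return zero    (suc g) h F = Σᴰ-first-return zero g h (F ∘ (d ∷_))
  Σᴰ-first-return (suc k) zero    h F =
    trans (cong (_+ Σᴰ (suc k) h (F ∘ (d ∷_))) (Σᴰ-first-return k 1 h (F ∘ (u ∷_))))
          (+-comm _ (Σᴰ (suc k) h (F ∘ (d ∷_))))
  Σᴰ-first-return (suc k) (suc g) h F = begin
    Σᴰ k (3 + g + h) (F ∘ (u ∷_)) + Σᴰ (suc k) (suc (g + h)) (F ∘ (d ∷_))
      ≡⟨ cong₂ _+_ (Σᴰ-first-return k (2 + g) h (F ∘ (u ∷_))) (Σᴰ-first-return (suc k) g h (F ∘ (d ∷_))) ⟩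
    convolve A k + (B 0 (suc k) + convolve (λ p → B (suc p)) k)
      ≡⟨ x∙yz≈y∙xz (convolve A k) (B 0 (suc k)) (convolve (λ p → B (suc p)) k) ⟩
    B 0 (suc k) + (convolve A k + convolve (λ p → B (suc p)) k)
      ≡⟨ cong (B 0 (suc k) +_) (convolve-+ k A (λ p → B (suc p))) ⟨
    B 0 (suc k) + convolve (λ p q → A p q + B (suc p) q) k
      ∎
    where
    open ≡-Reasoning
    A B : ℕ → ℕ → ℕ
    A p q = Σᴰ p (2 + g) (λ x → Σᴰ q h (λ y → F (u ∷ x ++ d ∷ y)))
    B p q = Σᴰ p g (λ x → Σᴰ q h (λ y → F (d ∷ x ++ d ∷ y)))

  Σʷ : ℕ → (List Step → ℕ) → ℕ
  Σʷ m F = sumℕ (map F (words m))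

  sumℕ-map-concatMap-ud : ∀ (F : List Step → ℕ) ws →
    sumℕ (map F (concatMap (λ w → (u ∷ w) ∷ (d ∷ w) ∷ []) ws))
      ≡ sumℕ (map (F ∘ (u ∷_)) ws) + sumℕ (map (F ∘ (d ∷_)) ws)
  sumℕ-map-concatMap-ud F []       = refl
  sumℕ-map-concatMap-ud F (w ∷ ws) =
    trans (cong (λ s → F (u ∷ w) + (F (d ∷ w) + s)) (sumℕ-map-concatMap-ud F ws))
          (trans (sym (+-assoc (F (u ∷ w)) (F (d ∷ w)) _))
                 (+-interchange (F (u ∷ w)) (F (d ∷ w)) _ _))

  Σʷ-suc : ∀ m F → Σʷ (suc m) F ≡ Σʷ m (F ∘ (u ∷_)) + Σʷ m (F ∘ (d ∷_))
  Σʷ-suc m F = sumℕ-map-concatMap-ud F (words m)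

  sumℕ-map-0 : ∀ {A : Set} (xs : List A) → sumℕ (map (λ _ → 0) xs) ≡ 0
  sumℕ-map-0 []       = refl
  sumℕ-map-0 (x ∷ xs) = sumℕ-map-0 xs

  sumℕ-map-filter : ∀ {A : Set} (p : A → Bool) (F : A → ℕ) xs →
    sumℕ (map F (filter (λ x → T? (p x)) xs)) ≡ sumℕ (map (λ x → if p x then F x else 0) xs)
  sumℕ-map-filter p F []       = refl
  sumℕ-map-filter p F (x ∷ xs) with p x
  ... | true  = cong (F x +_) (sumℕ-map-filter p F xs)
  ... | false = sumℕ-map-filter p F xs

  infix 5 _onDyckFrom_
  _onDyckFrom_ : (List Step → ℕ) → ℕ → List Step → ℕ
  (F onDyckFrom h) w = if dyckFrom h w then F w else 0

  Σʷ-short : ∀ m h F → m < h → Σʷ m (F onDyckFrom h) ≡ 0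
  Σʷ-short zero    (suc h)       F _ = refl
  Σʷ-short (suc m) (suc (suc h)) F (s≤s m<h) =
    trans (Σʷ-suc m (F onDyckFrom 2 + h))
          (cong₂ _+_ (Σʷ-short m (3 + h) (F ∘ (u ∷_)) (m<n⇒m<1+n (m<n⇒m<1+n m<h)))
                     (Σʷ-short m (suc h) (F ∘ (d ∷_)) m<h))

  Σʷ-Σᴰ : ∀ m k h F → m ≡ k + (k + h) → Σʷ m (F onDyckFrom h) ≡ Σᴰ k h F
  Σʷ-Σᴰ zero    zero    zero    F refl = +-identityʳ (F [])
  Σʷ-Σᴰ (suc m) zero    (suc h) F eq =
    trans (Σʷ-suc m (F onDyckFrom suc h))
          (cong₂ _+_ (Σʷ-short m (2 + h) (F ∘ (u ∷_)) (s≤s (m≤n⇒m≤1+n (≤-reflexive m≡h))))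
                     (Σʷ-Σᴰ m zero h (F ∘ (d ∷_)) m≡h))
    where m≡h = suc-injective eq
  Σʷ-Σᴰ (suc m) (suc k) zero    F eq =
    trans (Σʷ-suc m (F onDyckFrom 0))
          (trans (cong₂ _+_ (Σʷ-Σᴰ m k 1 (F ∘ (u ∷_)) (trans (suc-injective eq) (cong (k +_) (sym (+-suc k 0)))))
                            (sumℕ-map-0 (words m)))
                 (+-identityʳ (Σᴰ k 1 (F ∘ (u ∷_)))))
  Σʷ-Σᴰ (suc m) (suc k) (suc h) F eq =
    trans (Σʷ-suc m (F onDyckFrom suc h))
          (cong₂ _+_ (Σʷ-Σᴰ m k (2 + h) (F ∘ (u ∷_)) (trans m≡ up))
                     (Σʷ-Σᴰ m (suc k) h (F ∘ (d ∷_)) (trans m≡ down)))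
    where
    m≡ : m ≡ k + suc (k + suc h)
    m≡ = suc-injective eq
    up : k + suc (k + suc h) ≡ k + (k + (2 + h))
    up = cong (k +_) (sym (+-suc k (suc h)))
    down : k + suc (k + suc h) ≡ suc k + (suc k + h)
    down = trans (+-suc k (k + suc h)) (cong (λ x → suc (k + x)) (+-suc k h))

  sum-dyckPaths : ∀ n F → sumℕ (map F (dyckPaths n)) ≡ Σᴰ n 0 F
  sum-dyckPaths n F = trans (sumℕ-map-filter isDyck F (words (2 * n))) (Σʷ-Σᴰ (2 * n) n 0 F refl)

module Mountains where

  open import Data.Nat using (ℕ; zero; suc; _+_)
  open import Data.Bool using (Bool; true; false)
  open import Data.List using (List; _++_; map; replicate)
  open import Data.Product using (∃₂)
  open import Function using (_∘_)
  open import Relation.Binary.PropositionalEquality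

  Weight : Set
  Weight = ℕ → ℕ → ℕ

  weightSum : Weight → List (ℕ × ℕ) → ℕ
  weightSum g ms = sumℕ (map (λ { (i , j) → g i j }) ms)

  mountainSum : Weight → List Step → ℕ
  mountainSum g w = weightSum g (mountains w)

  -- climb g a w is the weight of the mountain whose ascent has made a up-steps and continues with w
  -- (0 if it never turns into a peak), descend g a b w the same after b steps of its descent; afterDowns f w
  -- sums f over the suffixes of w that follow a down-step.
  mutual
    climb : Weight → ℕ → List Step → ℕ
    climb g a       []      = 0
    climb g a       (u ∷ w) = climb g (suc a) w
    climb g zero    (d ∷ w) = 0
    climb g (suc a) (d ∷ w) = descend g (suc a) 1 w

    descend : Weight → ℕ → ℕ → List Step → ℕ
    descend g a b []      = g a b
    descend g a b (u ∷ w) = g a b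
    descend g a b (d ∷ w) = descend g a (suc b) w

  afterDowns : (List Step → ℕ) → List Step → ℕ
  afterDowns f []      = 0
  afterDowns f (u ∷ w) = afterDowns f w
  afterDowns f (d ∷ w) = f w + afterDowns f w

  startsWith : Step → List Step → Bool
  startsWith s []      = false
  startsWith s (t ∷ _) = sameStep s t

  sameStep-refl : ∀ s → sameStep s s ≡ true
  sameStep-refl u = refl
  sameStep-refl d = refl

  runs-∷ : ∀ s w → ∃₂ λ k r → runs (s ∷ w) ≡ (s , suc k) ∷ r
  runs-∷ s w with runs w
  ... | []          = 0 , [] , refl
  ... | (t , k) ∷ r with sameStep s t
  ...   | true  = k , r , refl
  ...   | false = 0 , (t , k) ∷ r , refl

  runs-replicate : ∀ s a w → startsWith s w ≡ false → runs (replicate (suc a) s ++ w) ≡ (s , suc a) ∷ runs w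
  runs-replicate s zero    []      _ = refl
  runs-replicate s zero    (t ∷ w) s≢t with runs-∷ t w
  ... | k , r , eq rewrite eq | s≢t = refl
  runs-replicate s (suc a) w       s∉w rewrite runs-replicate s a w s∉w | sameStep-refl s = refl

  mountains-d∷ : ∀ w → mountains (d ∷ w) ≡ mountains w
  mountains-d∷ w with runs w
  ... | []          = refl
  ... | (u , k) ∷ r = refl
  ... | (d , k) ∷ r = refl

  replicate-++-∷ : ∀ {A : Set} n (x : A) xs → replicate n x ++ x ∷ xs ≡ replicate (suc n) x ++ xs
  replicate-++-∷ zero    x xs = refl
  replicate-++-∷ (suc n) x xs = cong (x ∷_) (replicate-++-∷ n x xs)

  mutual
    mountainSum-climb : ∀ g a w → mountainSum g (replicate a u ++ w) ≡ climb g a w + afterDowns (climb g 0) w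
    mountainSum-climb g zero    []      = refl
    mountainSum-climb g (suc a) []      = cong (weightSum g ∘ mountainsR) (runs-replicate u a [] refl)
    mountainSum-climb g a       (u ∷ w) =
      trans (cong (mountainSum g) (replicate-++-∷ a u w)) (mountainSum-climb g (suc a) w)
    mountainSum-climb g zero    (d ∷ w) =
      trans (cong (weightSum g) (mountains-d∷ w)) (mountainSum-climb g zero w)
    mountainSum-climb g (suc a) (d ∷ w) = mountainSum-descend g a zero w

    mountainSum-descend : ∀ g a b w →
      mountainSum g (replicate (suc a) u ++ replicate (suc b) d ++ w)
        ≡ descend g (suc a) (suc b) w + afterDowns (climb g 0) (d ∷ w)
    mountainSum-descend g a b []      =
      cong (weightSum g ∘ mountainsR) (trans (runs-replicate u a (replicate (suc b) d ++ []) refl)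
                                             (cong ((u , suc a) ∷_) (runs-replicate d b [] refl)))
    mountainSum-descend g a b (u ∷ w) =
      trans (cong (weightSum g ∘ mountainsR) (trans (runs-replicate u a (replicate (suc b) d ++ u ∷ w) refl)
                                                    (cong ((u , suc a) ∷_) (runs-replicate d b (u ∷ w) refl))))
            (cong (g (suc a) (suc b) +_) (mountainSum-climb g 1 w))
    mountainSum-descend g a b (d ∷ w) =
      trans (cong (λ v → mountainSum g (replicate (suc a) u ++ v)) (replicate-++-∷ (suc b) d w))
            (mountainSum-descend g a (suc b) w)

  mountainSum-split : ∀ g w → mountainSum g w ≡ climb g 0 w + afterDowns (climb g 0) w
  mountainSum-split g = mountainSum-climb g 0

  -- Mountains have i, j ≥ 1, so a weight only matters at positive arguments.
  infix 4 _≗⁺_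
  _≗⁺_ : Weight → Weight → Set
  g ≗⁺ g′ = ∀ i j → g (suc i) (suc j) ≡ g′ (suc i) (suc j)

  descend-cong : ∀ {g g′} → g ≗⁺ g′ → ∀ a b w → descend g (suc a) (suc b) w ≡ descend g′ (suc a) (suc b) w
  descend-cong g≗g′ a b []      = g≗g′ a b
  descend-cong g≗g′ a b (u ∷ w) = g≗g′ a b
  descend-cong g≗g′ a b (d ∷ w) = descend-cong g≗g′ a (suc b) w

  climb-cong : ∀ {g g′} → g ≗⁺ g′ → ∀ a w → climb g a w ≡ climb g′ a w
  climb-cong g≗g′ a       []      = refl
  climb-cong g≗g′ a       (u ∷ w) = climb-cong g≗g′ (suc a) w
  climb-cong g≗g′ zero    (d ∷ w) = refl
  climb-cong g≗g′ (suc a) (d ∷ w) = descend-cong g≗g′ a 0 w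

  afterDowns-cong : ∀ {f f′ : List Step → ℕ} → (∀ w → f w ≡ f′ w) →
    ∀ w → afterDowns f w ≡ afterDowns f′ w
  afterDowns-cong f≗f′ []      = refl
  afterDowns-cong f≗f′ (u ∷ w) = afterDowns-cong f≗f′ w
  afterDowns-cong f≗f′ (d ∷ w) = cong₂ _+_ (f≗f′ w) (afterDowns-cong f≗f′ w)

  mountainSum-cong : ∀ {g g′} → g ≗⁺ g′ → ∀ w → mountainSum g w ≡ mountainSum g′ w
  mountainSum-cong {g} {g′} g≗g′ w = begin
    mountainSum g w
      ≡⟨ mountainSum-split g w ⟩
    climb g 0 w + afterDowns (climb g 0) w
      ≡⟨ cong₂ _+_ (climb-cong g≗g′ 0 w) (afterDowns-cong (climb-cong g≗g′ 0) w) ⟩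
    climb g′ 0 w + afterDowns (climb g′ 0) w
      ≡⟨ mountainSum-split g′ w ⟨
    mountainSum g′ w
      ∎
    where open ≡-Reasoning

  peaks : List Step → ℕ
  peaks []          = 0
  peaks (d ∷ w)     = peaks w
  peaks (u ∷ [])    = 0
  peaks (u ∷ u ∷ w) = peaks (u ∷ w)
  peaks (u ∷ d ∷ w) = suc (peaks w)

  one : Weight
  one _ _ = 1

  descend-one : ∀ a b w → descend one a b w ≡ 1
  descend-one a b []      = refl
  descend-one a b (u ∷ w) = refl
  descend-one a b (d ∷ w) = descend-one a (suc b) w

  mutual
    peaks-climb₀ : ∀ w → climb one 0 w + afterDowns (climb one 0) w ≡ peaks w
    peaks-climb₀ []      = refl
    peaks-climb₀ (u ∷ w) = peaks-climb w 0
    peaks-climb₀ (d ∷ w) = peaks-climb₀ w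

    peaks-climb : ∀ w a → climb one (suc a) w + afterDowns (climb one 0) w ≡ peaks (u ∷ w)
    peaks-climb []      a = refl
    peaks-climb (u ∷ w) a = peaks-climb w (suc a)
    peaks-climb (d ∷ w) a = cong₂ _+_ (descend-one (suc a) 1 w) (peaks-climb₀ w)

  mountainSum-one : ∀ w → mountainSum one w ≡ peaks w
  mountainSum-one w = trans (mountainSum-split one w) (peaks-climb₀ w)

  upOrEnd : List Step → ℕ
  upOrEnd []      = 1
  upOrEnd (u ∷ _) = 1
  upOrEnd (d ∷ _) = 0

  -- The positions where inserting ud creates a mountain ud: one more than there are peaks.
  upOrEnd-slots : ∀ w → upOrEnd w + afterDowns upOrEnd w ≡ suc (peaks w)
  upOrEnd-slots []          = refl
  upOrEnd-slots (d ∷ w)     = upOrEnd-slots w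
  upOrEnd-slots (u ∷ [])    = refl
  upOrEnd-slots (u ∷ u ∷ w) = upOrEnd-slots (u ∷ w)
  upOrEnd-slots (u ∷ d ∷ w) = cong suc (upOrEnd-slots w)

module PeakRemoval where

  open Paths
  open Mountains
  open import Data.Nat using (ℕ; zero; suc; _+_)
  open import Data.Nat.Properties using (+-identityʳ)
  open import Data.List using (List)
  open import Function using (_∘_)
  open import Relation.Binary.PropositionalEquality

  atLeast2 : Weight → Weight
  atLeast2 g (suc (suc i)) (suc (suc j)) = g (suc (suc i)) (suc (suc j))
  atLeast2 g _             _             = 0

  raise : Weight → Weight
  raise g i j = g (suc i) (suc j)

  Σᴰ-climb₀-flat : ∀ g h → Σᴰ 0 h (climb g 0) ≡ 0
  Σᴰ-climb₀-flat g zero    = refl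
  Σᴰ-climb₀-flat g (suc h) = Σᴰ-0 0 h

  Σᴰ-climb₀ : ∀ g k h → Σᴰ (suc k) h (climb g 0) ≡ Σᴰ k (suc h) (climb g 1)
  Σᴰ-climb₀ g k zero    = refl
  Σᴰ-climb₀ g k (suc h) = trans (cong (Σᴰ k (2 + h) (climb g 1) +_) (Σᴰ-0 (suc k) h)) (+-identityʳ _)

  Σᴰ-afterDowns-shift : ∀ {f f′ : List Step → ℕ} →
    (∀ h → Σᴰ 0 h f ≡ 0) → (∀ k h → Σᴰ (suc k) h f ≡ Σᴰ k h f′) →
    ∀ k h → Σᴰ (suc k) h (afterDowns f) ≡ Σᴰ k h (afterDowns f′)
  Σᴰ-afterDowns-shift {f} {f′} flat shift = go
    where
    flat′ : ∀ h → Σᴰ 0 h (afterDowns f) ≡ 0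
    flat′ zero    = refl
    flat′ (suc h) = trans (Σᴰ-+ 0 h f (afterDowns f)) (cong₂ _+_ (flat h) (flat′ h))

    go : ∀ k h → Σᴰ (suc k) h (afterDowns f) ≡ Σᴰ k h (afterDowns f′)
    down : ∀ k h → Σᴰ (suc k) h (λ w → f w + afterDowns f w) ≡ Σᴰ k h (λ w → f′ w + afterDowns f′ w)
    down k h = begin
      Σᴰ (suc k) h (λ w → f w + afterDowns f w)        ≡⟨ Σᴰ-+ (suc k) h f (afterDowns f) ⟩
      Σᴰ (suc k) h f + Σᴰ (suc k) h (afterDowns f)     ≡⟨ cong₂ _+_ (shift k h) (go k h) ⟩
      Σᴰ k h f′ + Σᴰ k h (afterDowns f′)               ≡⟨ Σᴰ-+ k h f′ (afterDowns f′) ⟨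
      Σᴰ k h (λ w → f′ w + afterDowns f′ w)            ∎
      where open ≡-Reasoning

    go zero    zero    = flat′ 1
    go (suc k) zero    = go k 1
    go zero    (suc h) = cong₂ _+_ (flat′ (2 + h)) (down zero h)
    go (suc k) (suc h) = cong₂ _+_ (go k (2 + h)) (down (suc k) h)

  -- Every mountain leads either the whole path or the suffix after one of its down-steps, so a shift of the
  -- sums of the leading mountain carries over to the sums of all mountains.
  Σᴰ-mountainSum-shift : ∀ g (f : List Step → ℕ) → (∀ k h → Σᴰ (suc k) h (climb g 0) ≡ Σᴰ k h f) →
    ∀ k h → Σᴰ (suc k) h (mountainSum g) ≡ Σᴰ k h (λ w → f w + afterDowns f w)
  Σᴰ-mountainSum-shift g f shift k h = begin
    Σᴰ (suc k) h (mountainSum g)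
      ≡⟨ Σᴰ-cong (suc k) h (mountainSum-split g) ⟩
    Σᴰ (suc k) h (λ w → climb g 0 w + afterDowns (climb g 0) w)
      ≡⟨ Σᴰ-+ (suc k) h (climb g 0) (afterDowns (climb g 0)) ⟩
    Σᴰ (suc k) h (climb g 0) + Σᴰ (suc k) h (afterDowns (climb g 0))
      ≡⟨ cong₂ _+_ (shift k h) (Σᴰ-afterDowns-shift (Σᴰ-climb₀-flat g) shift k h) ⟩
    Σᴰ k h f + Σᴰ k h (afterDowns f)
      ≡⟨ Σᴰ-+ k h f (afterDowns f) ⟨
    Σᴰ k h (λ w → f w + afterDowns f w)
      ∎
    where open ≡-Reasoning

  module Shrink (g : Weight) where

    descend-shrink : ∀ a b w → descend (atLeast2 g) (2 + a) (2 + b) w ≡ descend (raise g) (suc a) (suc b) w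
    descend-shrink a b []      = refl
    descend-shrink a b (u ∷ w) = refl
    descend-shrink a b (d ∷ w) = descend-shrink a (suc b) w

    descend-atLeast2-1 : ∀ b w → descend (atLeast2 g) 1 b w ≡ 0
    descend-atLeast2-1 b []      = refl
    descend-atLeast2-1 b (u ∷ w) = refl
    descend-atLeast2-1 b (d ∷ w) = descend-atLeast2-1 (suc b) w

    Σᴰ-climb-shrink : ∀ k h a → Σᴰ k (suc h) (climb (atLeast2 g) (2 + a)) ≡ Σᴰ k h (climb (raise g) (suc a))
    Σᴰ-climb-shrink zero    zero    a = refl
    Σᴰ-climb-shrink zero    (suc h) a = Σᴰ-cong zero h (descend-shrink a 0)
    Σᴰ-climb-shrink (suc k) zero    a =
      trans (cong₂ _+_ (Σᴰ-climb-shrink k 1 (suc a)) (Σᴰ-0 k 1)) (+-identityʳ _)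
    Σᴰ-climb-shrink (suc k) (suc h) a =
      cong₂ _+_ (Σᴰ-climb-shrink k (2 + h) (suc a))
                (trans (cong (_+ Σᴰ (suc k) h (descend (atLeast2 g) (2 + a) 2)) (Σᴰ-0 k (2 + h)))
                       (Σᴰ-cong (suc k) h (descend-shrink a 0)))

    Σᴰ-climb₀-shrink : ∀ k h → Σᴰ (suc k) h (climb (atLeast2 g) 0) ≡ Σᴰ k h (climb (raise g) 0)
    Σᴰ-climb₀-shrink zero    h = begin
      Σᴰ 1 h (climb (atLeast2 g) 0)   ≡⟨ Σᴰ-climb₀ (atLeast2 g) 0 h ⟩
      Σᴰ 0 h (descend (atLeast2 g) 1 1) ≡⟨ Σᴰ-vanishing 0 h (descend-atLeast2-1 1) ⟩
      0                                ≡⟨ Σᴰ-climb₀-flat (raise g) h ⟨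
      Σᴰ 0 h (climb (raise g) 0)      ∎
      where open ≡-Reasoning
    Σᴰ-climb₀-shrink (suc k) h = begin
      Σᴰ (2 + k) h (climb (atLeast2 g) 0)     ≡⟨ Σᴰ-climb₀ (atLeast2 g) (suc k) h ⟩
      Σᴰ k (2 + h) (climb (atLeast2 g) 2) + Σᴰ (suc k) h (descend (atLeast2 g) 1 1)
        ≡⟨ cong₂ _+_ (Σᴰ-climb-shrink k (suc h) 0) (Σᴰ-vanishing (suc k) h (descend-atLeast2-1 1)) ⟩
      Σᴰ k (suc h) (climb (raise g) 1) + 0    ≡⟨ +-identityʳ _ ⟩
      Σᴰ k (suc h) (climb (raise g) 1)        ≡⟨ Σᴰ-climb₀ (raise g) k h ⟨
      Σᴰ (suc k) h (climb (raise g) 0)        ∎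
      where open ≡-Reasoning

    Σᴰ-mountainSum-shrink : ∀ k h → Σᴰ (suc k) h (mountainSum (atLeast2 g)) ≡ Σᴰ k h (mountainSum (raise g))
    Σᴰ-mountainSum-shrink k h =
      trans (Σᴰ-mountainSum-shift (atLeast2 g) (climb (raise g) 0) Σᴰ-climb₀-shrink k h)
            (sym (Σᴰ-cong k h (mountainSum-split (raise g))))

  isolated : Weight
  isolated 1 1 = 1
  isolated _ _ = 0

  descend-isolated-high : ∀ a b w → descend isolated (2 + a) b w ≡ 0
  descend-isolated-high a b []      = refl
  descend-isolated-high a b (u ∷ w) = refl
  descend-isolated-high a b (d ∷ w) = descend-isolated-high a (suc b) w

  climb-isolated-high : ∀ a w → climb isolated (2 + a) w ≡ 0
  climb-isolated-high a []      = refl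
  climb-isolated-high a (u ∷ w) = climb-isolated-high (suc a) w
  climb-isolated-high a (d ∷ w) = descend-isolated-high a 1 w

  descend-isolated-wide : ∀ b w → descend isolated 1 (2 + b) w ≡ 0
  descend-isolated-wide b []      = refl
  descend-isolated-wide b (u ∷ w) = refl
  descend-isolated-wide b (d ∷ w) = descend-isolated-wide (suc b) w

  descend-isolated : ∀ w → descend isolated 1 1 w ≡ upOrEnd w
  descend-isolated []      = refl
  descend-isolated (u ∷ w) = refl
  descend-isolated (d ∷ w) = descend-isolated-wide 0 w

  Σᴰ-climb₀-isolated : ∀ k h → Σᴰ (suc k) h (climb isolated 0) ≡ Σᴰ k h upOrEnd
  Σᴰ-climb₀-isolated zero    h = trans (Σᴰ-climb₀ isolated 0 h) (Σᴰ-cong 0 h descend-isolated)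
  Σᴰ-climb₀-isolated (suc k) h =
    trans (Σᴰ-climb₀ isolated (suc k) h)
          (cong₂ _+_ (Σᴰ-vanishing k (2 + h) (climb-isolated-high 0)) (Σᴰ-cong (suc k) h descend-isolated))

  Σᴰ-mountainSum-isolated : ∀ k h → Σᴰ (suc k) h (mountainSum isolated) ≡ Σᴰ k h (suc ∘ peaks)
  Σᴰ-mountainSum-isolated k h =
    trans (Σᴰ-mountainSum-shift isolated upOrEnd Σᴰ-climb₀-isolated k h) (Σᴰ-cong k h upOrEnd-slots)

module Totals where

  open Paths
  open Mountains
  open PeakRemoval
  open import Data.Nat using (ℕ; zero; suc; _+_; _*_; _≡ᵇ_; _⊓_)
  open import Data.Nat.Properties using (+-identityʳ; +-comm; +-assoc; *-identityʳ; +-commutativeSemigroup)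
  open import Data.Bool using (T; true; false; if_then_else_)
  open import Data.List using (List; _++_)
  open import Function using (_∘_)
  open import Relation.Binary.PropositionalEquality
  open import Algebra.Properties.CommutativeSemigroup +-commutativeSemigroup using () renaming (interchange to +-interchange)

  infixl 6 _⊕_
  _⊕_ : Weight → Weight → Weight
  (g ⊕ g′) i j = g i j + g′ i j

  weightSum-⊕ : ∀ g g′ ms → weightSum (g ⊕ g′) ms ≡ weightSum g ms + weightSum g′ ms
  weightSum-⊕ g g′ []             = refl
  weightSum-⊕ g g′ ((i , j) ∷ ms) =
    trans (cong (g i j + g′ i j +_) (weightSum-⊕ g g′ ms)) (+-interchange (g i j) (g′ i j) _ _)

  total : Weight → ℕ → ℕ
  total g n = Σᴰ n 0 (mountainSum g)

  total-cong : ∀ {g g′} → g ≗⁺ g′ → ∀ n → total g n ≡ total g′ n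
  total-cong g≗g′ n = Σᴰ-cong n 0 (mountainSum-cong g≗g′)

  total-⊕ : ∀ g g′ n → total (g ⊕ g′) n ≡ total g n + total g′ n
  total-⊕ g g′ n =
    trans (Σᴰ-cong n 0 (weightSum-⊕ g g′ ∘ mountains)) (Σᴰ-+ n 0 (mountainSum g) (mountainSum g′))

  total-step : ∀ {g g′ g″ e} → g ≗⁺ atLeast2 g′ ⊕ e → raise g′ ≗⁺ g″ →
    ∀ n → total g (suc n) ≡ total g″ n + total e (suc n)
  total-step {g} {g′} {g″} {e} split shift n = begin
    total g (suc n)                                ≡⟨ total-cong split (suc n) ⟩
    total (atLeast2 g′ ⊕ e) (suc n)                ≡⟨ total-⊕ (atLeast2 g′) e (suc n) ⟩
    total (atLeast2 g′) (suc n) + total e (suc n)  ≡⟨ cong (_+ total e (suc n)) (Shrink.Σᴰ-mountainSum-shrink g′ n 0) ⟩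
    total (raise g′) n + total e (suc n)           ≡⟨ cong (_+ total e (suc n)) (total-cong shift n) ⟩
    total g″ n + total e (suc n)                   ∎
    where open ≡-Reasoning

  catalan peakTotal : ℕ → ℕ
  catalan   n = Σᴰ n 0 (λ _ → 1)
  peakTotal n = Σᴰ n 0 peaks

  total-one : ∀ n → total one n ≡ peakTotal n
  total-one n = Σᴰ-cong n 0 mountainSum-one

  total-isolated : ∀ n → total isolated (suc n) ≡ catalan n + peakTotal n
  total-isolated n = trans (Σᴰ-mountainSum-isolated n 0) (Σᴰ-+ n 0 (λ _ → 1) peaks)

  catalan-suc : ∀ n → catalan (suc n) ≡ convolve (λ p q → catalan p * catalan q) n
  catalan-suc n = trans (Σᴰ-first-return n 0 0 (λ _ → 1))
                        (convolve-cong n (λ p q → Σᴰ-product p 0 q 0 (λ _ → 1) (λ _ → 1)))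

  isEmpty : List Step → ℕ
  isEmpty []      = 1
  isEmpty (_ ∷ _) = 0

  unit : ℕ → ℕ
  unit n = Σᴰ n 0 isEmpty

  peaks-++-d∷ : ∀ h x y → T (dyckFrom h x) → peaks (x ++ d ∷ y) ≡ peaks x + peaks y
  peaks-++-d∷ h       []          y _ = refl
  peaks-++-d∷ (suc h) (d ∷ x)     y p = peaks-++-d∷ h x y p
  peaks-++-d∷ h       (u ∷ u ∷ x) y p = peaks-++-d∷ (suc h) (u ∷ x) y p
  peaks-++-d∷ h       (u ∷ d ∷ x) y p = cong suc (peaks-++-d∷ h x y p)

  peaks-wrap : ∀ x y → T (dyckFrom 0 x) → peaks (u ∷ x ++ d ∷ y) ≡ isEmpty x + peaks x + peaks y
  peaks-wrap []      y _ = refl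
  peaks-wrap (u ∷ x) y p = peaks-++-d∷ 0 (u ∷ x) y p

  peakTotal-suc : ∀ n →
    peakTotal (suc n) ≡ convolve (λ p q → unit p * catalan q + peakTotal p * catalan q + catalan p * peakTotal q) n
  peakTotal-suc n = trans (Σᴰ-first-return n 0 0 (peaks ∘ (u ∷_))) (convolve-cong n split)
    where
    ΣΣ : ℕ → ℕ → (List Step → List Step → ℕ) → ℕ
    ΣΣ p q H = Σᴰ p 0 (λ x → Σᴰ q 0 (H x))

    ΣΣ-+ : ∀ p q H K → ΣΣ p q (λ x y → H x y + K x y) ≡ ΣΣ p q H + ΣΣ p q K
    ΣΣ-+ p q H K = trans (Σᴰ-cong p 0 (λ x → Σᴰ-+ q 0 (H x) (K x))) (Σᴰ-+ p 0 _ _)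

    split : ∀ p q → ΣΣ p q (λ x y → peaks (u ∷ x ++ d ∷ y))
                      ≡ unit p * catalan q + peakTotal p * catalan q + catalan p * peakTotal q
    split p q = begin
      ΣΣ p q (λ x y → peaks (u ∷ x ++ d ∷ y))
        ≡⟨ Σᴰ-cong-dyck p 0 (λ x dx → Σᴰ-cong q 0 (λ y → trans (peaks-wrap x y dx) (as-products x y))) ⟩
      ΣΣ p q (λ x y → isEmpty x * 1 + peaks x * 1 + 1 * peaks y)
        ≡⟨ trans (ΣΣ-+ p q _ _) (cong (_+ ΣΣ p q (λ x y → 1 * peaks y)) (ΣΣ-+ p q _ _)) ⟩
      ΣΣ p q (λ x y → isEmpty x * 1) + ΣΣ p q (λ x y → peaks x * 1) + ΣΣ p q (λ x y → 1 * peaks y)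
        ≡⟨ cong₂ _+_ (cong₂ _+_ (Σᴰ-product p 0 q 0 isEmpty (λ _ → 1)) (Σᴰ-product p 0 q 0 peaks (λ _ → 1)))
                     (Σᴰ-product p 0 q 0 (λ _ → 1) peaks) ⟩
      unit p * catalan q + peakTotal p * catalan q + catalan p * peakTotal q
        ∎
      where
      open ≡-Reasoning
      as-products : ∀ x y → isEmpty x + peaks x + peaks y ≡ isEmpty x * 1 + peaks x * 1 + 1 * peaks y
      as-products x y =
        sym (cong₂ _+_ (cong₂ _+_ (*-identityʳ (isEmpty x)) (*-identityʳ (peaks x))) (+-identityʳ (peaks y)))

  unit-suc : ∀ n → unit (suc n) ≡ 0
  unit-suc n = Σᴰ-0 n 1

  symmetric asymmetric symmetricCount asymmetricCount : Weight
  symmetric       i j = if i ≡ᵇ j then i ⊓ j else 0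
  asymmetric      i j = if i ≡ᵇ j then 0 else i ⊓ j
  symmetricCount  i j = if i ≡ᵇ j then 1 else 0
  asymmetricCount i j = if i ≡ᵇ j then 0 else 1

  lowAsymmetric : Weight
  lowAsymmetric 1             (suc (suc _)) = 1
  lowAsymmetric (suc (suc _)) 1             = 1
  lowAsymmetric _             _             = 0

  symmetric-split : symmetric ≗⁺ atLeast2 symmetric ⊕ isolated
  symmetric-split zero    zero    = refl
  symmetric-split zero    (suc j) = refl
  symmetric-split (suc i) zero    = refl
  symmetric-split (suc i) (suc j) = sym (+-identityʳ _)

  symmetric-raise : raise symmetric ≗⁺ symmetric ⊕ symmetricCount
  symmetric-raise i j with i ≡ᵇ j
  ... | true  = +-comm 1 (suc (i ⊓ j))
  ... | false = refl

  symmetricCount-split : symmetricCount ≗⁺ atLeast2 symmetricCount ⊕ isolated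
  symmetricCount-split zero    zero    = refl
  symmetricCount-split zero    (suc j) = refl
  symmetricCount-split (suc i) zero    = refl
  symmetricCount-split (suc i) (suc j) = sym (+-identityʳ _)

  asymmetric-split : asymmetric ≗⁺ atLeast2 asymmetric ⊕ lowAsymmetric
  asymmetric-split zero    zero    = refl
  asymmetric-split zero    (suc j) = refl
  asymmetric-split (suc i) zero    = refl
  asymmetric-split (suc i) (suc j) = sym (+-identityʳ _)

  asymmetric-raise : raise asymmetric ≗⁺ asymmetric ⊕ asymmetricCount
  asymmetric-raise i j with i ≡ᵇ j
  ... | true  = refl
  ... | false = +-comm 1 (suc (i ⊓ j))

  asymmetricCount-split : asymmetricCount ≗⁺ atLeast2 asymmetricCount ⊕ lowAsymmetric
  asymmetricCount-split zero    zero    = refl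
  asymmetricCount-split zero    (suc j) = refl
  asymmetricCount-split (suc i) zero    = refl
  asymmetricCount-split (suc i) (suc j) = sym (+-identityʳ _)

  one-split : one ≗⁺ atLeast2 one ⊕ (isolated ⊕ lowAsymmetric)
  one-split zero    zero    = refl
  one-split zero    (suc j) = refl
  one-split (suc i) zero    = refl
  one-split (suc i) (suc j) = refl

  total-suc-partial : ∀ {g c} e → g ≗⁺ atLeast2 g ⊕ e → raise g ≗⁺ g ⊕ c →
    c ≗⁺ atLeast2 c ⊕ e → raise c ≗⁺ c →
    ∀ n → total g (suc n) ≡ total g n + total c (suc n)
  total-suc-partial {g} {c} e g-split g-raise c-split c-raise n = begin
    total g (suc n)                               ≡⟨ total-step g-split g-raise n ⟩
    total (g ⊕ c) n + total e (suc n)             ≡⟨ cong (_+ total e (suc n)) (total-⊕ g c n) ⟩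
    total g n + total c n + total e (suc n)       ≡⟨ +-assoc (total g n) (total c n) (total e (suc n)) ⟩
    total g n + (total c n + total e (suc n))     ≡⟨ cong (total g n +_) (total-step c-split c-raise n) ⟨
    total g n + total c (suc n)                   ∎
    where open ≡-Reasoning

module PowerSeries where

  import Data.Nat as ℕ
  open import Data.Nat using (zero; suc; _∸_; _≤_; z≤n; s≤s)
  open import Data.Nat.Properties using (m≤n⇒m<n∨m≡n) renaming (≤-refl to ≤ℕ-refl)
  open import Data.Integer using (ℤ; +_; _+_; _*_; -_; _-_; _≟_; NonZero)
  open import Data.Integer.Properties
  open import Data.List using (List)
  open import Data.List.Properties using (map-applyUpTo)
  import Data.Maybe as Maybe
  open import Data.Sum using (inj₁; inj₂)
  open import Function using (id; _∘_)
  open import Relation.Binary.PropositionalEquality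
  open import Relation.Nullary.Decidable using (dec⇒maybe)
  open import Data.Integer.Tactic.RingSolver using (solve-∀)
  open import Algebra.Properties.CommutativeSemigroup +-commutativeSemigroup
    using (x∙yz≈y∙xz) renaming (interchange to +-interchange)
  open import Algebra.Bundles using (CommutativeRing)
  open import Algebra.Solver.Ring.AlmostCommutativeRing using (fromCommutativeRing; _-Raw-AlmostCommutative⟶_)
  open import Level using (0ℓ)

  shift : PS → PS
  shift f n = f (suc n)

  *ₚ-zero : ∀ f g → (f *ₚ g) 0 ≡ f 0 * g 0
  *ₚ-zero f g = +-identityʳ (f 0 * g 0)

  *ₚ-suc : ∀ f g n → (f *ₚ g) (suc n) ≡ f 0 * g (suc n) + (shift f *ₚ g) n
  *ₚ-suc f g n = cong (λ x → f 0 * g (suc n) + x)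
    (trans (cong sumℤ (map-applyUpTo suc (λ k → f k * g (suc n ∸ k)) (suc n)))
           (sym (cong sumℤ (map-applyUpTo id (λ k → f (suc k) * g (n ∸ k)) (suc n)))))

  *ₚ-sucʳ : ∀ f g n → (f *ₚ g) (suc n) ≡ f (suc n) * g 0 + (f *ₚ shift g) n
  *ₚ-sucʳ f g zero = begin
    (f *ₚ g) 1                        ≡⟨ *ₚ-suc f g 0 ⟩
    f 0 * g 1 + (shift f *ₚ g) 0      ≡⟨ cong (λ x → f 0 * g 1 + x) (*ₚ-zero (shift f) g) ⟩
    f 0 * g 1 + f 1 * g 0             ≡⟨ +-comm (f 0 * g 1) (f 1 * g 0) ⟩
    f 1 * g 0 + f 0 * g 1             ≡⟨ cong (λ x → f 1 * g 0 + x) (*ₚ-zero f (shift g)) ⟨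
    f 1 * g 0 + (f *ₚ shift g) 0      ∎
    where open ≡-Reasoning
  *ₚ-sucʳ f g (suc n) = begin
    (f *ₚ g) (2 ℕ.+ n)
      ≡⟨ *ₚ-suc f g (suc n) ⟩
    f 0 * g (2 ℕ.+ n) + (shift f *ₚ g) (suc n)
      ≡⟨ cong (λ x → f 0 * g (2 ℕ.+ n) + x) (*ₚ-sucʳ (shift f) g n) ⟩
    f 0 * g (2 ℕ.+ n) + (f (2 ℕ.+ n) * g 0 + (shift f *ₚ shift g) n)
      ≡⟨ x∙yz≈y∙xz (f 0 * g (2 ℕ.+ n)) (f (2 ℕ.+ n) * g 0) ((shift f *ₚ shift g) n) ⟩
    f (2 ℕ.+ n) * g 0 + (f 0 * g (2 ℕ.+ n) + (shift f *ₚ shift g) n)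
      ≡⟨ cong (λ x → f (2 ℕ.+ n) * g 0 + x) (*ₚ-suc f (shift g) n) ⟨
    f (2 ℕ.+ n) * g 0 + (f *ₚ shift g) (suc n)
      ∎
    where open ≡-Reasoning

  0ₚ 1ₚ : PS
  0ₚ = poly []
  1ₚ = poly (+ 1 ∷ [])

  -ₚ_ : PS → PS
  (-ₚ f) n = - f n

  infixr 7 _·_
  _·_ : ℤ → PS → PS
  (c · f) n = c * f n

  *ₚ-cong : ∀ {f f′ g g′} → f ≈ₚ f′ → g ≈ₚ g′ → f *ₚ g ≈ₚ f′ *ₚ g′
  *ₚ-cong {f} {f′} {g} {g′} f≈ g≈ zero =
    trans (*ₚ-zero f g) (trans (cong₂ _*_ (f≈ 0) (g≈ 0)) (sym (*ₚ-zero f′ g′)))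
  *ₚ-cong {f} {f′} {g} {g′} f≈ g≈ (suc n) =
    trans (*ₚ-suc f g n)
          (trans (cong₂ _+_ (cong₂ _*_ (f≈ 0) (g≈ (suc n))) (*ₚ-cong (f≈ ∘ suc) g≈ n))
                 (sym (*ₚ-suc f′ g′ n)))

  *ₚ-congˡ : ∀ f {g g′} → g ≈ₚ g′ → f *ₚ g ≈ₚ f *ₚ g′
  *ₚ-congˡ f = *ₚ-cong {f} (λ _ → refl)

  +ₚ-congˡ : ∀ f {g g′} → g ≈ₚ g′ → f +ₚ g ≈ₚ f +ₚ g′
  +ₚ-congˡ f g≈g′ n = cong (_+_ (f n)) (g≈g′ n)

  -ₚ-congˡ : ∀ f {g g′} → g ≈ₚ g′ → f -ₚ g ≈ₚ f -ₚ g′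
  -ₚ-congˡ f g≈g′ n = cong (_-_ (f n)) (g≈g′ n)

  *ₚ-congʳ : ∀ {f f′} g → f ≈ₚ f′ → f *ₚ g ≈ₚ f′ *ₚ g
  *ₚ-congʳ g f≈f′ = *ₚ-cong f≈f′ (λ _ → refl)

  -ₚ-congʳ : ∀ {f f′} g → f ≈ₚ f′ → f -ₚ g ≈ₚ f′ -ₚ g
  -ₚ-congʳ g f≈f′ n = cong (_- g n) (f≈f′ n)

  *ₚ-comm : ∀ f g → f *ₚ g ≈ₚ g *ₚ f
  *ₚ-comm f g zero    = trans (*ₚ-zero f g) (trans (*-comm (f 0) (g 0)) (sym (*ₚ-zero g f)))
  *ₚ-comm f g (suc n) =
    trans (*ₚ-suc f g n)
          (trans (cong₂ _+_ (*-comm (f 0) (g (suc n))) (*ₚ-comm (shift f) g n))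
                 (sym (*ₚ-sucʳ g f n)))

  *ₚ-distribˡ : ∀ f g h → f *ₚ (g +ₚ h) ≈ₚ f *ₚ g +ₚ f *ₚ h
  *ₚ-distribˡ f g h zero =
    trans (*ₚ-zero f (g +ₚ h)) (trans (*-distribˡ-+ (f 0) (g 0) (h 0)) (sym (cong₂ _+_ (*ₚ-zero f g) (*ₚ-zero f h))))
  *ₚ-distribˡ f g h (suc n) =
    trans (*ₚ-suc f (g +ₚ h) n)
          (trans (cong₂ _+_ (*-distribˡ-+ (f 0) (g (suc n)) (h (suc n))) (*ₚ-distribˡ (shift f) g h n))
                 (trans (+-interchange (f 0 * g (suc n)) (f 0 * h (suc n)) ((shift f *ₚ g) n) ((shift f *ₚ h) n))
                        (sym (cong₂ _+_ (*ₚ-suc f g n) (*ₚ-suc f h n)))))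

  *ₚ-distribʳ : ∀ f g h → (g +ₚ h) *ₚ f ≈ₚ g *ₚ f +ₚ h *ₚ f
  *ₚ-distribʳ f g h n =
    trans (*ₚ-comm (g +ₚ h) f n) (trans (*ₚ-distribˡ f g h n) (cong₂ _+_ (*ₚ-comm f g n) (*ₚ-comm f h n)))

  ·-*ₚ : ∀ c f g → (c · f) *ₚ g ≈ₚ c · (f *ₚ g)
  ·-*ₚ c f g zero    = trans (*ₚ-zero (c · f) g) (trans (*-assoc c (f 0) (g 0)) (cong (c *_) (sym (*ₚ-zero f g))))
  ·-*ₚ c f g (suc n) =
    trans (*ₚ-suc (c · f) g n)
          (trans (cong₂ _+_ (*-assoc c (f 0) (g (suc n))) (·-*ₚ c (shift f) g n))
                 (trans (sym (*-distribˡ-+ c (f 0 * g (suc n)) ((shift f *ₚ g) n))) (cong (c *_) (sym (*ₚ-suc f g n)))))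

  shift-*ₚ : ∀ f g → shift (f *ₚ g) ≈ₚ f 0 · shift g +ₚ shift f *ₚ g
  shift-*ₚ f g = *ₚ-suc f g

  *ₚ-assoc : ∀ f g h → (f *ₚ g) *ₚ h ≈ₚ f *ₚ (g *ₚ h)
  *ₚ-assoc f g h zero = begin
    ((f *ₚ g) *ₚ h) 0        ≡⟨ *ₚ-zero (f *ₚ g) h ⟩
    (f *ₚ g) 0 * h 0         ≡⟨ cong (_* h 0) (*ₚ-zero f g) ⟩
    f 0 * g 0 * h 0          ≡⟨ *-assoc (f 0) (g 0) (h 0) ⟩
    f 0 * (g 0 * h 0)        ≡⟨ cong (f 0 *_) (*ₚ-zero g h) ⟨
    f 0 * (g *ₚ h) 0         ≡⟨ *ₚ-zero f (g *ₚ h) ⟨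
    (f *ₚ (g *ₚ h)) 0        ∎
    where open ≡-Reasoning
  *ₚ-assoc f g h (suc n) = begin
    ((f *ₚ g) *ₚ h) (suc n)
      ≡⟨ *ₚ-suc (f *ₚ g) h n ⟩
    (f *ₚ g) 0 * h (suc n) + (shift (f *ₚ g) *ₚ h) n
      ≡⟨ cong₂ _+_ (cong (_* h (suc n)) (*ₚ-zero f g)) (*ₚ-cong {g = h} (shift-*ₚ f g) (λ _ → refl) n) ⟩
    f 0 * g 0 * h (suc n) + ((f 0 · shift g +ₚ shift f *ₚ g) *ₚ h) n
      ≡⟨ cong (λ x → f 0 * g 0 * h (suc n) + x) (*ₚ-distribʳ h (f 0 · shift g) (shift f *ₚ g) n) ⟩
    f 0 * g 0 * h (suc n) + (((f 0 · shift g) *ₚ h) n + ((shift f *ₚ g) *ₚ h) n)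
      ≡⟨ cong (λ x → f 0 * g 0 * h (suc n) + x)
              (cong₂ _+_ (·-*ₚ (f 0) (shift g) h n) (*ₚ-assoc (shift f) g h n)) ⟩
    f 0 * g 0 * h (suc n) + (f 0 * (shift g *ₚ h) n + (shift f *ₚ (g *ₚ h)) n)
      ≡⟨ regroup (f 0) (g 0) (h (suc n)) ((shift g *ₚ h) n) ((shift f *ₚ (g *ₚ h)) n) ⟩
    f 0 * (g 0 * h (suc n) + (shift g *ₚ h) n) + (shift f *ₚ (g *ₚ h)) n
      ≡⟨ cong (λ x → f 0 * x + (shift f *ₚ (g *ₚ h)) n) (*ₚ-suc g h n) ⟨
    f 0 * (g *ₚ h) (suc n) + (shift f *ₚ (g *ₚ h)) n
      ≡⟨ *ₚ-suc f (g *ₚ h) n ⟨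
    (f *ₚ (g *ₚ h)) (suc n)
      ∎
    where
    open ≡-Reasoning
    regroup : ∀ a b c x y → a * b * c + (a * x + y) ≡ a * (b * c + x) + y
    regroup = solve-∀

  *ₚ-zeroˡ : ∀ f → 0ₚ *ₚ f ≈ₚ 0ₚ
  *ₚ-zeroˡ f zero    = *ₚ-zero 0ₚ f
  *ₚ-zeroˡ f (suc n) = trans (*ₚ-suc 0ₚ f n) (trans (+-identityˡ ((0ₚ *ₚ f) n)) (*ₚ-zeroˡ f n))

  *ₚ-identityˡ : ∀ f → 1ₚ *ₚ f ≈ₚ f
  *ₚ-identityˡ f zero    = trans (*ₚ-zero 1ₚ f) (*-identityˡ (f 0))
  *ₚ-identityˡ f (suc n) =
    trans (*ₚ-suc 1ₚ f n) (trans (cong₂ _+_ (*-identityˡ (f (suc n))) (*ₚ-zeroˡ f n)) (+-identityʳ (f (suc n))))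

  powerSeriesRing : CommutativeRing 0ℓ 0ℓ
  powerSeriesRing = record
    { Carrier = PS ; _≈_ = _≈ₚ_ ; _+_ = _+ₚ_ ; _*_ = _*ₚ_ ; -_ = -ₚ_ ; 0# = 0ₚ ; 1# = 1ₚ
    ; isCommutativeRing = record
      { isRing = record
        { +-isAbelianGroup = record
          { isGroup = record
            { isMonoid = record
              { isSemigroup = record
                { isMagma = record
                  { isEquivalence = record
                    { refl  = λ _ → refl
                    ; sym   = λ f≈g n → sym (f≈g n)
                    ; trans = λ f≈g g≈h n → trans (f≈g n) (g≈h n) }
                  ; ∙-cong = λ f≈ g≈ n → cong₂ _+_ (f≈ n) (g≈ n) }
                ; assoc = λ f g h n → +-assoc (f n) (g n) (h n) }
              ; identity = (λ f n → +-identityˡ (f n)) , (λ f n → +-identityʳ (f n)) }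
            ; inverse = (λ f n → +-inverseˡ (f n)) , (λ f n → +-inverseʳ (f n))
            ; ⁻¹-cong = λ f≈ n → cong -_ (f≈ n) }
          ; comm = λ f g n → +-comm (f n) (g n) }
        ; *-cong = *ₚ-cong
        ; *-assoc = *ₚ-assoc
        ; *-identity = *ₚ-identityˡ , (λ f n → trans (*ₚ-comm f 1ₚ n) (*ₚ-identityˡ f n))
        ; distrib = *ₚ-distribˡ , *ₚ-distribʳ }
      ; *-comm = *ₚ-comm } }

  cst : ℤ → PS
  cst c = poly (c ∷ [])

  X : PS
  X = poly (+ 0 ∷ + 1 ∷ [])

  cst-* : ∀ a b → cst (a * b) ≈ₚ cst a *ₚ cst b
  cst-* a b zero    = sym (*ₚ-zero (cst a) (cst b))
  cst-* a b (suc n) = sym (trans (*ₚ-suc (cst a) (cst b) n)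
                                  (trans (cong₂ _+_ (*-zeroʳ a) (*ₚ-zeroˡ (cst b) n)) (+-identityʳ (+ 0))))

  poly-∷ : ∀ a as → poly (a ∷ as) ≈ₚ cst a +ₚ X *ₚ poly as
  poly-∷ a as zero    = sym (trans (cong (_+_ a) (*ₚ-zero X (poly as))) (+-identityʳ a))
  poly-∷ a as (suc n) = sym (trans (+-identityˡ _) (trans (*ₚ-suc X (poly as) n)
                               (trans (+-identityˡ _) (*ₚ-identityˡ (poly as) n))))

  X*ₚ-zero : ∀ f → (X *ₚ f) 0 ≡ + 0
  X*ₚ-zero f = trans (*ₚ-zero X f) (*-zeroˡ (f 0))

  X*ₚ-suc : ∀ f n → (X *ₚ f) (suc n) ≡ f n
  X*ₚ-suc f n = trans (*ₚ-suc X f n) (trans (+-identityˡ _) (*ₚ-identityˡ f n))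

  -- poly as in terms of X and constants, a form the ring solver can read.
  horner : List ℤ → PS
  horner []       = cst (+ 0)
  horner (a ∷ as) = cst a +ₚ X *ₚ horner as

  poly-horner : ∀ as → poly as ≈ₚ horner as
  poly-horner []       zero    = refl
  poly-horner []       (suc n) = refl
  poly-horner (a ∷ as) n = trans (poly-∷ a as n) (cong (_+_ (cst a n)) (*ₚ-cong {X} (λ _ → refl) (poly-horner as) n))

  ℤ⟶PS : CommutativeRing.rawRing +-*-commutativeRing -Raw-AlmostCommutative⟶ fromCommutativeRing powerSeriesRing
  ℤ⟶PS = record
    { ⟦_⟧    = cst
    ; +-homo = λ a b → λ { zero → refl ; (suc n) → refl }
    ; *-homo = cst-*
    ; -‿homo = λ a → λ { zero → refl ; (suc n) → refl }
    ; 0-homo = λ { zero → refl ; (suc n) → refl }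
    ; 1-homo = λ { zero → refl ; (suc n) → refl } }

  cst-≟ : ∀ a b → Maybe.Maybe (cst a ≈ₚ cst b)
  cst-≟ a b = Maybe.map (λ { refl _ → refl }) (dec⇒maybe (a ≟ b))

  open import Algebra.Solver.Ring
    (CommutativeRing.rawRing +-*-commutativeRing) (fromCommutativeRing powerSeriesRing) ℤ⟶PS cst-≟
    public using (solve; _:=_; _:+_; _:*_; _:-_; con)

  *ₚ-vanishing : ∀ n e g → (∀ k → k ≤ n → e k ≡ + 0) → (e *ₚ g) n ≡ + 0
  *ₚ-vanishing zero    e g e≡0 = trans (*ₚ-zero e g) (cong (_* g 0) (e≡0 0 z≤n))
  *ₚ-vanishing (suc n) e g e≡0 =
    trans (*ₚ-suc e g n)
          (cong₂ _+_ (cong (_* g (suc n)) (e≡0 0 z≤n))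
                     (*ₚ-vanishing n (shift e) g (λ k k≤n → e≡0 (suc k) (s≤s k≤n))))

  *ₚ-cancel-zero : ∀ e f c .{{_ : NonZero c}} → f 0 ≡ c → e *ₚ f ≈ₚ 0ₚ → e ≈ₚ 0ₚ
  *ₚ-cancel-zero e f c f₀≡c ef≈0 n = vanishes-upTo n n ≤ℕ-refl
    where
    leading : ∀ n → (e *ₚ f) n ≡ e n * c → e n ≡ + 0
    leading n eq = *-cancelʳ-≡ (e n) (+ 0) c (trans (sym eq) (ef≈0 n))

    vanishes-upTo : ∀ n k → k ≤ n → e k ≡ + 0
    vanishes-upTo zero    zero    _   = leading 0 (trans (*ₚ-zero e f) (cong (e 0 *_) f₀≡c))
    vanishes-upTo (suc n) k       k≤n with m≤n⇒m<n∨m≡n k≤n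
    ... | inj₁ (s≤s k≤n′) = vanishes-upTo n k k≤n′
    ... | inj₂ refl       = leading (suc n)
      (trans (*ₚ-sucʳ e f n)
             (trans (cong₂ _+_ (cong (e (suc n) *_) f₀≡c) (*ₚ-vanishing n e (shift f) (vanishes-upTo n)))
                    (+-identityʳ _)))

  square-root-unique : ∀ a b → a 0 ≡ + 1 → b 0 ≡ + 1 → a *ₚ a ≈ₚ b *ₚ b → a ≈ₚ b
  square-root-unique a b a₀ b₀ a²≈b² n = i-j≡0⇒i≡j (a n) (b n) (a-b≈0 n)
    where
    a-b≈0 : a -ₚ b ≈ₚ 0ₚ
    a-b≈0 = *ₚ-cancel-zero (a -ₚ b) (a +ₚ b) (+ 2) (cong₂ _+_ a₀ b₀) λ n →
      trans (solve 2 (λ a b → (a :- b) :* (a :+ b) := a :* a :- b :* b) (λ _ → refl) a b n)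
            (trans (cong (_- (b *ₚ b) n) (a²≈b² n)) (+-inverseʳ ((b *ₚ b) n)))

  cst-*ₚ : ∀ c f n → (cst c *ₚ f) n ≡ c * f n
  cst-*ₚ c f zero    = *ₚ-zero (cst c) f
  cst-*ₚ c f (suc n) = trans (*ₚ-suc (cst c) f n) (trans (cong (_+_ (c * f (suc n))) (*ₚ-zeroˡ f n)) (+-identityʳ _))

  cst-*ₚ-cancel : ∀ c .{{_ : NonZero c}} {f g} → cst c *ₚ f ≈ₚ cst c *ₚ g → f ≈ₚ g
  cst-*ₚ-cancel c {f} {g} eq n = *-cancelˡ-≡ c (f n) (g n) (trans (sym (cst-*ₚ c f n)) (trans (eq n) (cst-*ₚ c g n)))

  1-X : PS
  1-X = 1ₚ -ₚ X

  1-X-*ₚ : ∀ F G → F ≈ₚ G +ₚ X *ₚ F → 1-X *ₚ F ≈ₚ G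
  1-X-*ₚ F G F≈ n =
    trans (solve 2 (λ z f → (con (+ 1) :- z) :* f := f :- z :* f) (λ _ → refl) X F n)
          (trans (-ₚ-congʳ (X *ₚ F) F≈ n) (solve 2 (λ g y → g :+ y :- y := g) (λ _ → refl) G (X *ₚ F) n))

open import Data.Integer using (+_; -[1+_])
open PowerSeries

module SeriesIdentities
  (C P E s : PS)
  (catalan-eq  : C ≈ₚ 1ₚ +ₚ X *ₚ (C *ₚ C))
  (peaks-eq    : P ≈ₚ X *ₚ (C +ₚ P *ₚ C +ₚ C *ₚ P))
  (isolated-eq : E ≈ₚ X *ₚ (C +ₚ P))
  (s₀ : s 0 ≡ + 1) (s² : s *ₚ s ≈ₚ poly (+ 1 ∷ -[1+ 3 ] ∷ []))
  where

  open import Data.Integer using (_+_; _-_)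
  import Relation.Binary.PropositionalEquality as ≡
  open import Algebra.Bundles using (CommutativeRing)
  open import Relation.Binary.Reasoning.Setoid (CommutativeRing.setoid powerSeriesRing)
  open CommutativeRing powerSeriesRing using () renaming (trans to ≈-trans)

  t : PS
  t = 1ₚ -ₚ X *ₚ (cst (+ 2) *ₚ C)

  t₀ : t 0 ≡ + 1
  t₀ = ≡.cong (_-_ (+ 1)) (X*ₚ-zero (cst (+ 2) *ₚ C))

  t² : t *ₚ t ≈ₚ poly (+ 1 ∷ -[1+ 3 ] ∷ [])
  t² = begin
    t *ₚ t
      ≈⟨ solve 2 (λ z c → (con (+ 1) :- z :* (con (+ 2) :* c)) :* (con (+ 1) :- z :* (con (+ 2) :* c))
                         := con (+ 1) :+ con (+ 4) :* z :* (z :* (c :* c)) :- con (+ 4) :* z :* c)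
               (λ _ → ≡.refl) X C ⟩
    1ₚ +ₚ cst (+ 4) *ₚ X *ₚ (X *ₚ (C *ₚ C)) -ₚ cst (+ 4) *ₚ X *ₚ C
      ≈⟨ -ₚ-congˡ (1ₚ +ₚ cst (+ 4) *ₚ X *ₚ (X *ₚ (C *ₚ C))) (*ₚ-congˡ (cst (+ 4) *ₚ X) catalan-eq) ⟩
    1ₚ +ₚ cst (+ 4) *ₚ X *ₚ (X *ₚ (C *ₚ C)) -ₚ cst (+ 4) *ₚ X *ₚ (1ₚ +ₚ X *ₚ (C *ₚ C))
      ≈⟨ solve 2 (λ z c → con (+ 1) :+ con (+ 4) :* z :* (z :* (c :* c)) :- con (+ 4) :* z :* (con (+ 1) :+ z :* (c :* c))
                         := con (+ 1) :+ z :* (con -[1+ 3 ] :+ z :* con (+ 0)))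
               (λ _ → ≡.refl) X C ⟩
    horner (+ 1 ∷ -[1+ 3 ] ∷ [])
      ≈⟨ poly-horner (+ 1 ∷ -[1+ 3 ] ∷ []) ⟨
    poly (+ 1 ∷ -[1+ 3 ] ∷ [])
      ∎

  s≈t : s ≈ₚ t
  s≈t = square-root-unique s t s₀ t₀ (λ n → ≡.trans (s² n) (≡.sym (t² n)))

  2XC≈1-s : X *ₚ (cst (+ 2) *ₚ C) ≈ₚ 1ₚ -ₚ s
  2XC≈1-s = begin
    X *ₚ (cst (+ 2) *ₚ C)
      ≈⟨ solve 2 (λ z c → z :* (con (+ 2) :* c) := con (+ 1) :- (con (+ 1) :- z :* (con (+ 2) :* c))) (λ _ → ≡.refl) X C ⟩
    1ₚ -ₚ t
      ≈⟨ -ₚ-congˡ 1ₚ s≈t ⟨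
    1ₚ -ₚ s
      ∎

  sP≈XC : s *ₚ P ≈ₚ X *ₚ C
  sP≈XC = begin
    s *ₚ P
      ≈⟨ *ₚ-congʳ P s≈t ⟩
    t *ₚ P
      ≈⟨ solve 3 (λ z c p → (con (+ 1) :- z :* (con (+ 2) :* c)) :* p := p :- con (+ 2) :* z :* (c :* p))
               (λ _ → ≡.refl) X C P ⟩
    P -ₚ cst (+ 2) *ₚ X *ₚ (C *ₚ P)
      ≈⟨ -ₚ-congʳ (cst (+ 2) *ₚ X *ₚ (C *ₚ P)) peaks-eq ⟩
    X *ₚ (C +ₚ P *ₚ C +ₚ C *ₚ P) -ₚ cst (+ 2) *ₚ X *ₚ (C *ₚ P)
      ≈⟨ solve 3 (λ z c p → z :* (c :+ p :* c :+ c :* p) :- con (+ 2) :* z :* (c :* p) := z :* c) (λ _ → ≡.refl) X C P ⟩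
    X *ₚ C
      ∎

  s²≈ : s *ₚ s ≈ₚ horner (+ 1 ∷ -[1+ 3 ] ∷ [])
  s²≈ n = ≡.trans (s² n) (poly-horner (+ 1 ∷ -[1+ 3 ] ∷ []) n)

  module Symmetric (Sc S : PS) (Sc-eq : Sc ≈ₚ E +ₚ X *ₚ Sc) (S-eq : S ≈ₚ Sc +ₚ X *ₚ S) where

    identity : poly (+ 2 ∷ -[1+ 3 ] ∷ + 2 ∷ []) *ₚ s *ₚ S
                 ≈ₚ poly (-[1+ 0 ] ∷ + 5 ∷ []) +ₚ poly (+ 1 ∷ -[1+ 0 ] ∷ []) *ₚ s
    identity = begin
      poly (+ 2 ∷ -[1+ 3 ] ∷ + 2 ∷ []) *ₚ s *ₚ S
        ≈⟨ *ₚ-congʳ S (*ₚ-congʳ s (poly-horner (+ 2 ∷ -[1+ 3 ] ∷ + 2 ∷ []))) ⟩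
      horner (+ 2 ∷ -[1+ 3 ] ∷ + 2 ∷ []) *ₚ s *ₚ S
        ≈⟨ solve 3 (λ z s S → (con (+ 2) :+ z :* (con -[1+ 3 ] :+ z :* (con (+ 2) :+ z :* con (+ 0)))) :* s :* S
                              := con (+ 2) :* s :* ((con (+ 1) :- z) :* ((con (+ 1) :- z) :* S)))
               (λ _ → ≡.refl) X s S ⟩
      cst (+ 2) *ₚ s *ₚ (1-X *ₚ (1-X *ₚ S))
        ≈⟨ *ₚ-congˡ (cst (+ 2) *ₚ s) (≈-trans (*ₚ-congˡ 1-X (1-X-*ₚ S Sc S-eq)) (1-X-*ₚ Sc E Sc-eq)) ⟩
      cst (+ 2) *ₚ s *ₚ E
        ≈⟨ *ₚ-congˡ (cst (+ 2) *ₚ s) isolated-eq ⟩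
      cst (+ 2) *ₚ s *ₚ (X *ₚ (C +ₚ P))
        ≈⟨ solve 4 (λ z s c p → con (+ 2) :* s :* (z :* (c :+ p))
                                := z :* (con (+ 2) :* c) :* s :+ con (+ 2) :* z :* (s :* p))
               (λ _ → ≡.refl) X s C P ⟩
      X *ₚ (cst (+ 2) *ₚ C) *ₚ s +ₚ cst (+ 2) *ₚ X *ₚ (s *ₚ P)
        ≈⟨ +ₚ-congˡ (X *ₚ (cst (+ 2) *ₚ C) *ₚ s) (*ₚ-congˡ (cst (+ 2) *ₚ X) sP≈XC) ⟩
      X *ₚ (cst (+ 2) *ₚ C) *ₚ s +ₚ cst (+ 2) *ₚ X *ₚ (X *ₚ C)
        ≈⟨ solve 3 (λ z s c → z :* (con (+ 2) :* c) :* s :+ con (+ 2) :* z :* (z :* c) := z :* (con (+ 2) :* c) :* (s :+ z))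
               (λ _ → ≡.refl) X s C ⟩
      X *ₚ (cst (+ 2) *ₚ C) *ₚ (s +ₚ X)
        ≈⟨ *ₚ-congʳ (s +ₚ X) 2XC≈1-s ⟩
      (1ₚ -ₚ s) *ₚ (s +ₚ X)
        ≈⟨ solve 2 (λ z s → (con (+ 1) :- s) :* (s :+ z) := s :+ z :- z :* s :- s :* s) (λ _ → ≡.refl) X s ⟩
      s +ₚ X -ₚ X *ₚ s -ₚ s *ₚ s
        ≈⟨ -ₚ-congˡ (s +ₚ X -ₚ X *ₚ s) s²≈ ⟩
      s +ₚ X -ₚ X *ₚ s -ₚ horner (+ 1 ∷ -[1+ 3 ] ∷ [])
        ≈⟨ solve 2 (λ z s → s :+ z :- z :* s :- (con (+ 1) :+ z :* (con -[1+ 3 ] :+ z :* con (+ 0)))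
                          := (con -[1+ 0 ] :+ z :* (con (+ 5) :+ z :* con (+ 0)))
                             :+ (con (+ 1) :+ z :* (con -[1+ 0 ] :+ z :* con (+ 0))) :* s)
               (λ _ → ≡.refl) X s ⟩
      horner (-[1+ 0 ] ∷ + 5 ∷ []) +ₚ horner (+ 1 ∷ -[1+ 0 ] ∷ []) *ₚ s
        ≈⟨ (λ n → ≡.cong₂ _+_ (poly-horner (-[1+ 0 ] ∷ + 5 ∷ []) n)
                              (*ₚ-congʳ s (poly-horner (+ 1 ∷ -[1+ 0 ] ∷ [])) n)) ⟨
      poly (-[1+ 0 ] ∷ + 5 ∷ []) +ₚ poly (+ 1 ∷ -[1+ 0 ] ∷ []) *ₚ s
        ∎

  module Asymmetric (E₁ Ac A : PS) (low-eq : P ≈ₚ (E +ₚ E₁) +ₚ X *ₚ P)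
                    (Ac-eq : Ac ≈ₚ E₁ +ₚ X *ₚ Ac) (A-eq : A ≈ₚ Ac +ₚ X *ₚ A) where

    E₁≈ : E₁ ≈ₚ 1-X *ₚ P -ₚ X *ₚ (C +ₚ P)
    E₁≈ = begin
      E₁                            ≈⟨ solve 2 (λ e e₁ → e₁ := (e :+ e₁) :- e) (λ _ → ≡.refl) E E₁ ⟩
      (E +ₚ E₁) -ₚ E                ≈⟨ -ₚ-congʳ E (1-X-*ₚ P (E +ₚ E₁) low-eq) ⟨
      1-X *ₚ P -ₚ E                 ≈⟨ -ₚ-congˡ (1-X *ₚ P) isolated-eq ⟩
      1-X *ₚ P -ₚ X *ₚ (C +ₚ P)     ∎

    -- Only 2zC, not zC, can be rewritten in terms of s.
    identity-doubled : cst (+ 2) *ₚ (poly (+ 1 ∷ -[1+ 1 ] ∷ + 1 ∷ []) *ₚ s *ₚ A)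
                         ≈ₚ cst (+ 2) *ₚ (poly (+ 1 ∷ -[1+ 2 ] ∷ []) -ₚ poly (+ 1 ∷ -[1+ 0 ] ∷ []) *ₚ s)
    identity-doubled = begin
      cst (+ 2) *ₚ (poly (+ 1 ∷ -[1+ 1 ] ∷ + 1 ∷ []) *ₚ s *ₚ A)
        ≈⟨ *ₚ-congˡ (cst (+ 2)) (*ₚ-congʳ A (*ₚ-congʳ s (poly-horner (+ 1 ∷ -[1+ 1 ] ∷ + 1 ∷ [])))) ⟩
      cst (+ 2) *ₚ (horner (+ 1 ∷ -[1+ 1 ] ∷ + 1 ∷ []) *ₚ s *ₚ A)
        ≈⟨ solve 3 (λ z s a → con (+ 2) :* ((con (+ 1) :+ z :* (con -[1+ 1 ] :+ z :* (con (+ 1) :+ z :* con (+ 0)))) :* s :* a)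
                              := con (+ 2) :* s :* ((con (+ 1) :- z) :* ((con (+ 1) :- z) :* a)))
               (λ _ → ≡.refl) X s A ⟩
      cst (+ 2) *ₚ s *ₚ (1-X *ₚ (1-X *ₚ A))
        ≈⟨ *ₚ-congˡ (cst (+ 2) *ₚ s) (≈-trans (*ₚ-congˡ 1-X (1-X-*ₚ A Ac A-eq)) (1-X-*ₚ Ac E₁ Ac-eq)) ⟩
      cst (+ 2) *ₚ s *ₚ E₁
        ≈⟨ *ₚ-congˡ (cst (+ 2) *ₚ s) E₁≈ ⟩
      cst (+ 2) *ₚ s *ₚ (1-X *ₚ P -ₚ X *ₚ (C +ₚ P))
        ≈⟨ solve 4 (λ z s c p → con (+ 2) :* s :* ((con (+ 1) :- z) :* p :- z :* (c :+ p))
                                := con (+ 2) :* (con (+ 1) :- con (+ 2) :* z) :* (s :* p) :- z :* (con (+ 2) :* c) :* s)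
               (λ _ → ≡.refl) X s C P ⟩
      cst (+ 2) *ₚ (1ₚ -ₚ cst (+ 2) *ₚ X) *ₚ (s *ₚ P) -ₚ X *ₚ (cst (+ 2) *ₚ C) *ₚ s
        ≈⟨ -ₚ-congʳ (X *ₚ (cst (+ 2) *ₚ C) *ₚ s)
                    (*ₚ-congˡ (cst (+ 2) *ₚ (1ₚ -ₚ cst (+ 2) *ₚ X)) sP≈XC) ⟩
      cst (+ 2) *ₚ (1ₚ -ₚ cst (+ 2) *ₚ X) *ₚ (X *ₚ C) -ₚ X *ₚ (cst (+ 2) *ₚ C) *ₚ s
        ≈⟨ solve 3 (λ z s c → con (+ 2) :* (con (+ 1) :- con (+ 2) :* z) :* (z :* c) :- z :* (con (+ 2) :* c) :* s
                              := z :* (con (+ 2) :* c) :* (con (+ 1) :- con (+ 2) :* z :- s))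
               (λ _ → ≡.refl) X s C ⟩
      X *ₚ (cst (+ 2) *ₚ C) *ₚ (1ₚ -ₚ cst (+ 2) *ₚ X -ₚ s)
        ≈⟨ *ₚ-congʳ (1ₚ -ₚ cst (+ 2) *ₚ X -ₚ s) 2XC≈1-s ⟩
      (1ₚ -ₚ s) *ₚ (1ₚ -ₚ cst (+ 2) *ₚ X -ₚ s)
        ≈⟨ solve 2 (λ z s → (con (+ 1) :- s) :* (con (+ 1) :- con (+ 2) :* z :- s)
                          := con (+ 1) :- con (+ 2) :* z :- con (+ 2) :* s :+ con (+ 2) :* z :* s :+ s :* s)
               (λ _ → ≡.refl) X s ⟩
      1ₚ -ₚ cst (+ 2) *ₚ X -ₚ cst (+ 2) *ₚ s +ₚ cst (+ 2) *ₚ X *ₚ s +ₚ s *ₚ s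
        ≈⟨ +ₚ-congˡ (1ₚ -ₚ cst (+ 2) *ₚ X -ₚ cst (+ 2) *ₚ s +ₚ cst (+ 2) *ₚ X *ₚ s) s²≈ ⟩
      1ₚ -ₚ cst (+ 2) *ₚ X -ₚ cst (+ 2) *ₚ s +ₚ cst (+ 2) *ₚ X *ₚ s +ₚ horner (+ 1 ∷ -[1+ 3 ] ∷ [])
        ≈⟨ solve 2 (λ z s → con (+ 1) :- con (+ 2) :* z :- con (+ 2) :* s :+ con (+ 2) :* z :* s
                              :+ (con (+ 1) :+ z :* (con -[1+ 3 ] :+ z :* con (+ 0)))
                          := con (+ 2) :* ((con (+ 1) :+ z :* (con -[1+ 2 ] :+ z :* con (+ 0)))
                                           :- (con (+ 1) :+ z :* (con -[1+ 0 ] :+ z :* con (+ 0))) :* s))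
               (λ _ → ≡.refl) X s ⟩
      cst (+ 2) *ₚ (horner (+ 1 ∷ -[1+ 2 ] ∷ []) -ₚ horner (+ 1 ∷ -[1+ 0 ] ∷ []) *ₚ s)
        ≈⟨ *ₚ-congˡ (cst (+ 2)) (λ n → ≡.cong₂ _-_ (poly-horner (+ 1 ∷ -[1+ 2 ] ∷ []) n)
                                                   (*ₚ-congʳ s (poly-horner (+ 1 ∷ -[1+ 0 ] ∷ [])) n)) ⟨
      cst (+ 2) *ₚ (poly (+ 1 ∷ -[1+ 2 ] ∷ []) -ₚ poly (+ 1 ∷ -[1+ 0 ] ∷ []) *ₚ s)
        ∎

    identity : poly (+ 1 ∷ -[1+ 1 ] ∷ + 1 ∷ []) *ₚ s *ₚ A
                 ≈ₚ poly (+ 1 ∷ -[1+ 2 ] ∷ []) -ₚ poly (+ 1 ∷ -[1+ 0 ] ∷ []) *ₚ s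
    identity = cst-*ₚ-cancel (+ 2) identity-doubled

module GeneratingFunctions where

  open Paths
  open Mountains
  open PeakRemoval
  open Totals
  open import Data.Nat as ℕ using (ℕ; zero; suc)
  import Data.Nat.Properties as ℕP
  open import Data.Integer using (+_; _+_)
  open import Data.Integer.Properties using (+-identityʳ; +-identityˡ; pos-+; pos-*)
  open import Data.List using (map)
  open import Relation.Binary.PropositionalEquality

  ⟪_⟫ : (ℕ → ℕ) → PS
  ⟪ f ⟫ n = + f n

  gf-recurrence : ∀ f G → (∀ n → + f (suc n) ≡ G n) → ⟪ f ⟫ ≈ₚ cst (+ f 0) +ₚ X *ₚ G
  gf-recurrence f G eq zero    = sym (trans (cong (_+_ (+ f 0)) (X*ₚ-zero G)) (+-identityʳ (+ f 0)))
  gf-recurrence f G eq (suc n) = trans (eq n) (sym (trans (+-identityˡ _) (X*ₚ-suc G n)))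

  gf-partial-sums : ∀ f g → f 0 ≡ g 0 → (∀ n → f (suc n) ≡ f n ℕ.+ g (suc n)) →
    ⟪ f ⟫ ≈ₚ ⟪ g ⟫ +ₚ X *ₚ ⟪ f ⟫
  gf-partial-sums f g f₀ eq zero    =
    sym (trans (cong₂ _+_ (cong +_ (sym f₀)) (X*ₚ-zero ⟪ f ⟫)) (+-identityʳ (+ f 0)))
  gf-partial-sums f g f₀ eq (suc n) =
    trans (cong +_ (trans (eq n) (ℕP.+-comm (f n) (g (suc n)))))
          (trans (pos-+ (g (suc n)) (f n)) (cong (_+_ (+ g (suc n))) (sym (X*ₚ-suc ⟪ f ⟫ n))))

  gf-convolve : ∀ n (f g : ℕ → ℕ) → + convolve (λ p q → f p ℕ.* g q) n ≡ (⟪ f ⟫ *ₚ ⟪ g ⟫) n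
  gf-convolve zero    f g = trans (pos-* (f 0) (g 0)) (sym (*ₚ-zero ⟪ f ⟫ ⟪ g ⟫))
  gf-convolve (suc n) f g =
    trans (pos-+ (f 0 ℕ.* g (suc n)) _)
          (trans (cong₂ _+_ (pos-* (f 0) (g (suc n))) (gf-convolve n (λ p → f (suc p)) g))
                 (sym (*ₚ-suc ⟪ f ⟫ ⟪ g ⟫ n)))

  C P E E₁ Sc Ac : PS
  C  = ⟪ catalan ⟫
  P  = ⟪ peakTotal ⟫
  E  = ⟪ total isolated ⟫
  E₁ = ⟪ total lowAsymmetric ⟫
  Sc = ⟪ total symmetricCount ⟫
  Ac = ⟪ total asymmetricCount ⟫

  gf-catalan : C ≈ₚ 1ₚ +ₚ X *ₚ (C *ₚ C)
  gf-catalan = gf-recurrence catalan (C *ₚ C) (λ n → trans (cong +_ (catalan-suc n)) (gf-convolve n catalan catalan))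

  gf-unit : ⟪ unit ⟫ ≈ₚ 1ₚ
  gf-unit zero    = refl
  gf-unit (suc n) = cong +_ (unit-suc n)

  gf-peakTotal : P ≈ₚ X *ₚ (C +ₚ P *ₚ C +ₚ C *ₚ P)
  gf-peakTotal zero    = sym (X*ₚ-zero (C +ₚ P *ₚ C +ₚ C *ₚ P))
  gf-peakTotal (suc n) = begin
    + peakTotal (suc n)
      ≡⟨ cong +_ (trans (peakTotal-suc n) (trans (convolve-+ n (λ p q → UC p q ℕ.+ PC p q) CP)
                                               (cong (ℕ._+ convolve CP n) (convolve-+ n UC PC)))) ⟩
    + (convolve UC n ℕ.+ convolve PC n ℕ.+ convolve CP n)
      ≡⟨ trans (pos-+ (convolve UC n ℕ.+ convolve PC n) (convolve CP n))
               (cong (_+ + convolve CP n) (pos-+ (convolve UC n) (convolve PC n))) ⟩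
    + convolve UC n + + convolve PC n + + convolve CP n
      ≡⟨ cong₂ _+_ (cong₂ _+_ (trans (gf-convolve n unit catalan) (trans (*ₚ-congʳ C gf-unit n) (*ₚ-identityˡ C n)))
                              (gf-convolve n peakTotal catalan))
                   (gf-convolve n catalan peakTotal) ⟩
    (C +ₚ P *ₚ C +ₚ C *ₚ P) n
      ≡⟨ X*ₚ-suc (C +ₚ P *ₚ C +ₚ C *ₚ P) n ⟨
    (X *ₚ (C +ₚ P *ₚ C +ₚ C *ₚ P)) (suc n)
      ∎
    where
    open ≡-Reasoning
    UC PC CP : ℕ → ℕ → ℕ
    UC p q = unit p ℕ.* catalan q
    PC p q = peakTotal p ℕ.* catalan q
    CP p q = catalan p ℕ.* peakTotal q

  gf-isolated : E ≈ₚ X *ₚ (C +ₚ P)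
  gf-isolated zero    = sym (X*ₚ-zero (C +ₚ P))
  gf-isolated (suc n) =
    trans (cong +_ (total-isolated n)) (trans (pos-+ (catalan n) (peakTotal n)) (sym (X*ₚ-suc (C +ₚ P) n)))

  gf-peakTotal-partial : P ≈ₚ (E +ₚ E₁) +ₚ X *ₚ P
  gf-peakTotal-partial n =
    trans (gf-partial-sums peakTotal (λ m → total isolated m ℕ.+ total lowAsymmetric m) refl step n)
          (cong (_+ (X *ₚ P) n) (pos-+ (total isolated n) (total lowAsymmetric n)))
    where
    step : ∀ n → peakTotal (suc n) ≡ peakTotal n ℕ.+ (total isolated (suc n) ℕ.+ total lowAsymmetric (suc n))
    step n = begin
      peakTotal (suc n)                      ≡⟨ total-one (suc n) ⟨
      total one (suc n)                      ≡⟨ total-step one-split (λ _ _ → refl) n ⟩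
      total one n ℕ.+ total (isolated ⊕ lowAsymmetric) (suc n)
        ≡⟨ cong₂ ℕ._+_ (total-one n) (total-⊕ isolated lowAsymmetric (suc n)) ⟩
      peakTotal n ℕ.+ (total isolated (suc n) ℕ.+ total lowAsymmetric (suc n)) ∎
      where open ≡-Reasoning

  gf-symmetricCount : Sc ≈ₚ E +ₚ X *ₚ Sc
  gf-symmetricCount = gf-partial-sums _ _ refl (total-step symmetricCount-split (λ _ _ → refl))

  gf-asymmetricCount : Ac ≈ₚ E₁ +ₚ X *ₚ Ac
  gf-asymmetricCount = gf-partial-sums _ _ refl (total-step asymmetricCount-split (λ _ _ → refl))

  gf-SPW : SPW ≈ₚ Sc +ₚ X *ₚ SPW
  gf-SPW = gf-partial-sums (λ n → sumℕ (map spw (dyckPaths n))) (total symmetricCount) refl λ n →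
    trans (sum-dyckPaths (suc n) spw)
          (trans (total-suc-partial isolated symmetric-split symmetric-raise symmetricCount-split (λ _ _ → refl) n)
                 (cong (ℕ._+ total symmetricCount (suc n)) (sym (sum-dyckPaths n spw))))

  gf-APW : APW ≈ₚ Ac +ₚ X *ₚ APW
  gf-APW = gf-partial-sums (λ n → sumℕ (map apw (dyckPaths n))) (total asymmetricCount) refl λ n →
    trans (sum-dyckPaths (suc n) apw)
          (trans (total-suc-partial lowAsymmetric asymmetric-split asymmetric-raise asymmetricCount-split (λ _ _ → refl) n)
                 (cong (ℕ._+ total asymmetricCount (suc n)) (sym (sum-dyckPaths n apw))))

open GeneratingFunctions

corollary2p6 : (s : PS) → s 0 ≡ + 1
    → s *ₚ s ≈ₚ poly (+ 1 ∷ -[1+ 3 ] ∷ [])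
    → (poly (+ 2 ∷ -[1+ 3 ] ∷ + 2 ∷ []) *ₚ s *ₚ SPW
      ≈ₚ poly (-[1+ 0 ] ∷ + 5 ∷ []) +ₚ poly (+ 1 ∷ -[1+ 0 ] ∷ []) *ₚ s)
    × (poly (+ 1 ∷ -[1+ 1 ] ∷ + 1 ∷ []) *ₚ s *ₚ APW
      ≈ₚ poly (+ 1 ∷ -[1+ 2 ] ∷ []) -ₚ poly (+ 1 ∷ -[1+ 0 ] ∷ []) *ₚ s)
corollary2p6 s s₀ s² =
    Symmetric.identity Sc SPW gf-symmetricCount gf-SPW
  , Asymmetric.identity E₁ Ac APW gf-peakTotal-partial gf-asymmetricCount gf-APW
  where open SeriesIdentities C P E s gf-catalan gf-peakTotal gf-isolated s₀ s²
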